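{- Let $G$ be a connected finite simple graph with at least one leaf, and let $G'$ be a graph obtained from $G$ by attaching any number of new leaves to support vertices of $G$. Then $G$ is well-totally dominated if and only if $G'$ is well-totally dominated.
   Context: A leaf is a vertex of degree 1; a support vertex is a vertex adjacent to a leaf. A total dominating set (TDS) of a graph is a set $S$ of vertices such that every vertex of the graph is adjacent to some vertex of $S$; a minimal TDS is one with no proper subset that is a TDS. A graph is well-totally dominated if all its minimal TDSs have the same size. -}

module Defs where

open import Data.Nat using (ℕ; _+_)
open import Data.Bool using (Bool; true; false)
open import Data.Fin using (Fin; splitAt; _≟_)
open import Data.Fin.Subset using (Subset; _∈_; _⊂_; ∣_∣)
open import Data.Vec using (tabulate)
open import Data.Sum using (inj₁; inj₂)
open import Data.Product using (Σ; ∃; _×_)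
open import Relation.Binary.PropositionalEquality using (_≡_)
open import Relation.Nullary using (¬_)
open import Relation.Nullary.Decidable using (⌊_⌋)

record Graph (n : ℕ) : Set where
  field
    adj   : Fin n → Fin n → Bool
    sym   : ∀ i j → adj i j ≡ adj j i
    irrefl : ∀ i → adj i i ≡ false
open Graph public

module _ {n : ℕ} (G : Graph n) where

  Adj : Fin n → Fin n → Set
  Adj i j = adj G i j ≡ true

  N : Fin n → Subset n
  N v = tabulate (adj G v)

  degree : Fin n → ℕ
  degree v = ∣ N v ∣

  Leaf : Fin n → Set
  Leaf v = degree v ≡ 1

  HasLeaf : Set
  HasLeaf = ∃ λ v → Leaf v

  Support : Fin n → Set
  Support v = ∃ λ u → Adj v u × Leaf u

  data Walk : Fin n → Fin n → Set where
    here : ∀ {v} → Walk v v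
    step : ∀ {u v w} → Adj u v → Walk v w → Walk u w

  Connected : Set
  Connected = ∀ u v → Walk u v

  IsTDS : Subset n → Set
  IsTDS S = ∀ v → ∃ λ u → u ∈ S × Adj v u

  IsMinimalTDS : Subset n → Set
  IsMinimalTDS S = IsTDS S × (∀ T → T ⊂ S → ¬ IsTDS T)

  WellTotallyDominated : Set
  WellTotallyDominated =
    ∀ S T → IsMinimalTDS S → IsMinimalTDS T → ∣ S ∣ ≡ ∣ T ∣

-- G' = G with m new vertices n, …, n+m-1 attached, the k-th new vertex
-- being a leaf adjacent exactly to the old vertex f k.
attachLeaves : ∀ {n} → Graph n → (m : ℕ) → (Fin m → Fin n) → Graph (n + m)
attachLeaves {n} G m f = record { adj = a ; sym = s ; irrefl = r }
  where
  a : Fin (n + m) → Fin (n + m) → Bool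
  a i j with splitAt n i | splitAt n j
  ... | inj₁ x | inj₁ y = adj G x y
  ... | inj₁ x | inj₂ k = ⌊ f k ≟ x ⌋
  ... | inj₂ k | inj₁ y = ⌊ f k ≟ y ⌋
  ... | inj₂ _ | inj₂ _ = false

  s : ∀ i j → a i j ≡ a j i
  s i j with splitAt n i | splitAt n j
  ... | inj₁ x | inj₁ y = Graph.sym G x y
  ... | inj₁ x | inj₂ k = Relation.Binary.PropositionalEquality.refl
  ... | inj₂ k | inj₁ y = Relation.Binary.PropositionalEquality.refl
  ... | inj₂ _ | inj₂ _ = Relation.Binary.PropositionalEquality.refl

  r : ∀ i → a i i ≡ false
  r i with splitAt n i
  ... | inj₁ x = irrefl G x
  ... | inj₂ _ = Relation.Binary.PropositionalEquality.refl

{-# OPTIONS --safe #-}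
-- Every support vertex lies in every total dominating set.  Hence a minimal TDS S of G is
-- also a minimal TDS of G′ (each new leaf is dominated by its support), and a minimal TDS of
-- G′ containing no new leaf is one of G.  A minimal TDS of G′ containing a new leaf ℓ at the
-- support s cannot contain an old leaf u at s, because N(ℓ) = {s} ⊆ N(u) would make ℓ
-- redundant.  Then u is not a support of G′ (supports lie in every TDS), so N(u) = {s} in G′
-- as well, and exchanging ℓ for u gives a minimal TDS of the same size with one new leaf fewer.
-- So G and G′ have the same minimal TDS sizes.

module Submission where

open import Defs
open import Data.Nat using (ℕ; suc; _+_; _<_)
open import Data.Fin using (Fin)
open import Function.Bundles using (_⇔_)

open import Data.Nat.Induction using (<-wellFounded)
open import Data.Nat.Properties using (n<1⇒n≡0; n≮0; ≤-reflexive)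
open import Data.Bool using (false)
open import Data.Bool.Properties using (T-≡)
open import Data.Fin using (zero; suc; _↑ˡ_; _↑ʳ_; splitAt; _≟_)
open import Data.Fin.Properties using (splitAt-↑ˡ; splitAt-↑ʳ; splitAt⁻¹-↑ˡ; splitAt⁻¹-↑ʳ)
open import Data.Fin.Subset using (Subset; inside; outside; ⊥; _∈_; _∉_; _⊆_; _⊂_; _-_; ∣_∣)
open import Data.Fin.Subset.Properties
  using (_∈?_; ∉⊥; ∣⊥∣≡0; drop-not-there; Empty-unique; nonempty?; x∈p∧x≢y⇒x∈p-y; x∈p⇒∣p-x∣<∣p∣)
open import Data.Vec using ([]; _∷_; _++_; _[_]≔_; here; there)
import Data.Vec as Vec
open import Data.Vec.Properties
  using ([]=-injective; []=⇒lookup; lookup⇒[]=; lookup∘tabulate; lookup∘update′;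
         []≔-updates; []≔-minimal; []≔-++-↑ˡ; []≔-++-↑ʳ)
open import Data.Product using (∃; _×_; _,_; proj₁; proj₂)
open import Data.Sum using (inj₁; inj₂)
open import Function using (_∘_)
open import Function.Bundles using (mk⇔; Equivalence)
open import Induction.WellFounded using (Acc; acc)
open import Relation.Binary.PropositionalEquality as ≡ using (_≡_; _≢_; refl; trans; cong; subst)
open import Relation.Nullary using (¬_; yes; no; contradiction)
open import Relation.Nullary.Decidable using (⌊_⌋; toWitness; fromWitness)

∣p∣≡1⇒x≡y : ∀ {n} {p : Subset n} {x y} → ∣ p ∣ ≡ 1 → x ∈ p → y ∈ p → x ≡ y
∣p∣≡1⇒x≡y {p = p} {x = x} {y = y} ∣p∣≡1 x∈p y∈p with x ≟ y
... | yes x≡y = x≡y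
... | no x≢y = contradiction (subst (∣ p - x - y ∣ <_) ∣p-x∣≡0 (x∈p⇒∣p-x∣<∣p∣ y∈p-x)) n≮0
  where
  y∈p-x : y ∈ p - x
  y∈p-x = x∈p∧x≢y⇒x∈p-y y∈p (x≢y ∘ ≡.sym)
  ∣p-x∣≡0 : ∣ p - x ∣ ≡ 0
  ∣p-x∣≡0 = n<1⇒n≡0 (subst (∣ p - x ∣ <_) ∣p∣≡1 (x∈p⇒∣p-x∣<∣p∣ x∈p))

x∉p⇒∣p[x]≔inside∣≡1+∣p∣ : ∀ {n} {x : Fin n} {p} → x ∉ p → ∣ p [ x ]≔ inside ∣ ≡ suc ∣ p ∣
x∉p⇒∣p[x]≔inside∣≡1+∣p∣ {x = zero}  {p = outside ∷ p} _   = refl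
x∉p⇒∣p[x]≔inside∣≡1+∣p∣ {x = zero}  {p = inside  ∷ p} x∉p = contradiction here x∉p
x∉p⇒∣p[x]≔inside∣≡1+∣p∣ {x = suc x} {p = inside  ∷ p} x∉p =
  cong suc (x∉p⇒∣p[x]≔inside∣≡1+∣p∣ (drop-not-there x∉p))
x∉p⇒∣p[x]≔inside∣≡1+∣p∣ {x = suc x} {p = outside ∷ p} x∉p =
  x∉p⇒∣p[x]≔inside∣≡1+∣p∣ (drop-not-there x∉p)

x∈p⇒1+∣p[x]≔outside∣≡∣p∣ : ∀ {n} {x : Fin n} {p} → x ∈ p → suc ∣ p [ x ]≔ outside ∣ ≡ ∣ p ∣
x∈p⇒1+∣p[x]≔outside∣≡∣p∣                        here        = refl
x∈p⇒1+∣p[x]≔outside∣≡∣p∣ {p = inside  ∷ _} (there x∈p) = cong suc (x∈p⇒1+∣p[x]≔outside∣≡∣p∣ x∈p)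
x∈p⇒1+∣p[x]≔outside∣≡∣p∣ {p = outside ∷ _} (there x∈p) = x∈p⇒1+∣p[x]≔outside∣≡∣p∣ x∈p

∈-update⁻ : ∀ {n} {x y : Fin n} {p s} → x ≢ y → x ∈ p [ y ]≔ s → x ∈ p
∈-update⁻ {x = x} {p = p} x≢y x∈ =
  lookup⇒[]= x p (trans (≡.sym (lookup∘update′ x≢y p _)) ([]=⇒lookup x∈))

exchange : ∀ {n} → Subset n → Fin n → Fin n → Subset n
exchange p x y = p [ x ]≔ outside [ y ]≔ inside

y∈exchange : ∀ {n} {p : Subset n} {x y} → y ∈ exchange p x y
y∈exchange = []≔-updates _ _

x∉exchange : ∀ {n} {x y : Fin n} {p} → x ≢ y → x ∉ exchange p x y
x∉exchange {x = x} {p = p} x≢y x∈ =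
  contradiction ([]=-injective (∈-update⁻ x≢y x∈) ([]≔-updates p x)) λ ()

∈-exchange⁺ : ∀ {n} {w x y : Fin n} {p} → w ≢ x → w ∈ p → w ∈ exchange p x y
∈-exchange⁺ {w = w} {x} {y} w≢x w∈p with w ≟ y
... | yes refl = y∈exchange
... | no w≢y = []≔-minimal _ w y w≢y ([]≔-minimal _ w x w≢x w∈p)

∈-exchange⁻ : ∀ {n} {w x y : Fin n} {p} → w ≢ x → w ≢ y → w ∈ exchange p x y → w ∈ p
∈-exchange⁻ w≢x w≢y = ∈-update⁻ w≢x ∘ ∈-update⁻ w≢y

∣exchange∣≡∣p∣ : ∀ {n} {x y : Fin n} {p} → x ∈ p → y ∉ p → ∣ exchange p x y ∣ ≡ ∣ p ∣
∣exchange∣≡∣p∣ {x = x} {y} {p} x∈p y∉p = trans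
  (x∉p⇒∣p[x]≔inside∣≡1+∣p∣ (y∉p ∘ ∈-update⁻ y≢x))
  (x∈p⇒1+∣p[x]≔outside∣≡∣p∣ x∈p)
  where
  y≢x : y ≢ x
  y≢x refl = y∉p x∈p

⊆exchange⇒⊂ : ∀ {n} {a b : Fin n} {S T} → a ≢ b → a ∈ S → b ∉ T → T ⊆ exchange S a b → T ⊂ S
⊆exchange⇒⊂ {a = a} {b} a≢b a∈S b∉T T⊆ = T⊆S , a , a∈S , x∉exchange a≢b ∘ T⊆
  where
  T⊆S : _ ⊆ _
  T⊆S {x} x∈T with x ≟ a | x ≟ b
  ... | yes refl | _        = a∈S
  ... | no _     | yes refl = contradiction x∈T b∉T
  ... | no x≢a   | no x≢b   = ∈-exchange⁻ x≢a x≢b (T⊆ x∈T)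

⊂exchange⇒exchange⊂ : ∀ {n} {a b : Fin n} {S T} → a ≢ b → a ∈ S → b ∈ T → T ⊂ exchange S a b →
               exchange T b a ⊂ S
⊂exchange⇒exchange⊂ {a = a} {b} a≢b a∈S b∈T (T⊆ , y , y∈ , y∉T) =
  ⊆S , y , ∈-exchange⁻ y≢a y≢b y∈ , y∉T ∘ ∈-exchange⁻ y≢b y≢a
  where
  y≢a : y ≢ a
  y≢a refl = x∉exchange a≢b y∈
  y≢b : y ≢ b
  y≢b refl = y∉T b∈T
  ⊆S : exchange _ b a ⊆ _
  ⊆S {x} x∈ with x ≟ a | x ≟ b
  ... | yes refl | _        = a∈S
  ... | no _     | yes refl = contradiction x∈ (x∉exchange (a≢b ∘ ≡.sym))
  ... | no x≢a   | no x≢b   = ∈-exchange⁻ x≢a x≢b (T⊆ (∈-exchange⁻ x≢b x≢a x∈))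

∈-++ˡ⁺ : ∀ {n m} {x : Fin n} {p} {q : Subset m} → x ∈ p → x ↑ˡ m ∈ p ++ q
∈-++ˡ⁺ here        = here
∈-++ˡ⁺ (there x∈p) = there (∈-++ˡ⁺ x∈p)

∈-++ˡ⁻ : ∀ {n m} {x : Fin n} {q : Subset m} (p : Subset n) → x ↑ˡ m ∈ p ++ q → x ∈ p
∈-++ˡ⁻ {x = zero}  (_ ∷ p) here      = here
∈-++ˡ⁻ {x = suc x} (_ ∷ p) (there i) = there (∈-++ˡ⁻ p i)

∈-++ʳ⁺ : ∀ {n m} {x : Fin m} {q : Subset m} (p : Subset n) → x ∈ q → n ↑ʳ x ∈ p ++ q
∈-++ʳ⁺ []      x∈q = x∈q
∈-++ʳ⁺ (_ ∷ p) x∈q = there (∈-++ʳ⁺ p x∈q)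

∈-++ʳ⁻ : ∀ {n m} {x : Fin m} {q : Subset m} (p : Subset n) → n ↑ʳ x ∈ p ++ q → x ∈ q
∈-++ʳ⁻ []      i         = i
∈-++ʳ⁻ (_ ∷ p) (there i) = ∈-++ʳ⁻ p i

∣p++⊥∣≡∣p∣ : ∀ {n m} (p : Subset n) → ∣ p ++ ⊥ {n = m} ∣ ≡ ∣ p ∣
∣p++⊥∣≡∣p∣ {m = m} []       = ∣⊥∣≡0 m
∣p++⊥∣≡∣p∣ (inside  ∷ p) = cong suc (∣p++⊥∣≡∣p∣ p)
∣p++⊥∣≡∣p∣ (outside ∷ p) = ∣p++⊥∣≡∣p∣ p

data SplitAt (n m : ℕ) : Fin (n + m) → Set where
  left  : (x : Fin n) → SplitAt n m (x ↑ˡ m)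
  right : (k : Fin m) → SplitAt n m (n ↑ʳ k)

splitAt-view : ∀ n {m} (i : Fin (n + m)) → SplitAt n m i
splitAt-view n {m} i with splitAt n {m} i in eq
... | inj₁ x = subst (SplitAt n m) (splitAt⁻¹-↑ˡ eq) (left x)
... | inj₂ k = subst (SplitAt n m) (splitAt⁻¹-↑ʳ eq) (right k)

↑ʳ≢↑ˡ : ∀ {n m} {k : Fin m} {x : Fin n} → n ↑ʳ k ≢ x ↑ˡ m
↑ʳ≢↑ˡ {n} {m} {k} {x} eq =
  contradiction (trans (≡.sym (splitAt-↑ʳ n m k)) (trans (cong (splitAt n) eq) (splitAt-↑ˡ n x m)))
                λ ()

++⊥-⊂⁺ : ∀ {n m} {p q : Subset n} → p ⊂ q → p ++ ⊥ {n = m} ⊂ q ++ ⊥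
++⊥-⊂⁺ {n} {m} {p} {q} (p⊆q , x , x∈q , x∉p) = ⊆ , x ↑ˡ m , ∈-++ˡ⁺ x∈q , x∉p ∘ ∈-++ˡ⁻ p
  where
  ⊆ : p ++ ⊥ ⊆ q ++ ⊥
  ⊆ {i} i∈ with splitAt-view n i
  ... | left y  = ∈-++ˡ⁺ (p⊆q (∈-++ˡ⁻ p i∈))
  ... | right k = contradiction (∈-++ʳ⁻ p i∈) ∉⊥

++⊥-⊂⁻ : ∀ {n m} {p q : Subset n} → p ++ ⊥ {n = m} ⊂ q ++ ⊥ → p ⊂ q
++⊥-⊂⁻ {n} {q = q} (⊆ , i , i∈q , i∉p) with splitAt-view n i
... | left x  = ∈-++ˡ⁻ q ∘ ⊆ ∘ ∈-++ˡ⁺ , x , ∈-++ˡ⁻ q i∈q , i∉p ∘ ∈-++ˡ⁺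
... | right k = contradiction (∈-++ʳ⁻ q i∈q) ∉⊥

++-⊆-++⊥ : ∀ {n m} {p p′ : Subset n} {q : Subset m} → p ++ q ⊆ p′ ++ ⊥ → q ≡ ⊥
++-⊆-++⊥ {p = p} {p′ = p′} ⊆ = Empty-unique λ (k , k∈q) → ∉⊥ (∈-++ʳ⁻ p′ (⊆ (∈-++ʳ⁺ p k∈q)))

module _ {n} (H : Graph n) where

  Adj-sym : ∀ {x y} → Adj H x y → Adj H y x
  Adj-sym {x} {y} = trans (Graph.sym H y x)

  Adj⇒∈N : ∀ {x y} → Adj H x y → y ∈ N H x
  Adj⇒∈N {x} {y} x~y = lookup⇒[]= y (N H x) (trans (lookup∘tabulate (adj H x) y) x~y)

  ∈N⇒Adj : ∀ {x y} → y ∈ N H x → Adj H x y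
  ∈N⇒Adj {x} {y} y∈ = trans (≡.sym (lookup∘tabulate (adj H x) y)) ([]=⇒lookup y∈)

  N⊆N⇒Adj : ∀ {a b v} → N H a ⊆ N H b → Adj H v a → Adj H v b
  N⊆N⇒Adj Na⊆Nb = Adj-sym ∘ ∈N⇒Adj ∘ Na⊆Nb ∘ Adj⇒∈N ∘ Adj-sym

  leaf-neighbour-unique : ∀ {u x y} → Leaf H u → Adj H u x → Adj H u y → x ≡ y
  leaf-neighbour-unique leaf u~x u~y = ∣p∣≡1⇒x≡y leaf (Adj⇒∈N u~x) (Adj⇒∈N u~y)

  sole-neighbour∈TDS : ∀ {u s S} → (∀ {v} → Adj H u v → v ≡ s) → IsTDS H S → s ∈ S
  sole-neighbour∈TDS {u} {S = S} sole tds with tds u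
  ... | w , w∈S , u~w = subst (_∈ S) (sole u~w) w∈S

  support∈TDS : ∀ {s S} → Support H s → IsTDS H S → s ∈ S
  support∈TDS (u , s~u , leaf) =
    sole-neighbour∈TDS (λ u~v → leaf-neighbour-unique leaf u~v (Adj-sym s~u))

  IsTDS-exchange : ∀ {a b S} → N H a ⊆ N H b → IsTDS H S → IsTDS H (exchange S a b)
  IsTDS-exchange {a} Na⊆Nb tds v with tds v
  ... | w , w∈S , v~w with w ≟ a
  ...   | yes refl = _ , y∈exchange , N⊆N⇒Adj Na⊆Nb v~w
  ...   | no w≢a   = w , ∈-exchange⁺ w≢a w∈S , v~w

  module _ {a b} (a≢b : a ≢ b) (Na⊆Nb : N H a ⊆ N H b)
           {S} (minimal : IsMinimalTDS H S) (a∈S : a ∈ S) where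

    N⊆N⇒∉minimalTDS : b ∉ S
    N⊆N⇒∉minimalTDS b∈S = proj₂ minimal (exchange S a b) (exchange⊆S , a , a∈S , x∉exchange a≢b)
                                         (IsTDS-exchange Na⊆Nb (proj₁ minimal))
      where
      exchange⊆S : exchange S a b ⊆ S
      exchange⊆S {x} x∈ with x ≟ a | x ≟ b
      ... | yes refl | _        = a∈S
      ... | no _     | yes refl = b∈S
      ... | no x≢a   | no x≢b   = ∈-exchange⁻ x≢a x≢b x∈

    IsMinimalTDS-exchange : N H b ⊆ N H a → IsMinimalTDS H (exchange S a b)
    IsMinimalTDS-exchange Nb⊆Na = IsTDS-exchange Na⊆Nb (proj₁ minimal) , no-smaller
      where
      no-smaller : ∀ T → T ⊂ exchange S a b → ¬ IsTDS H T
      no-smaller T T⊂ tdsT with b ∈? T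
      ... | yes b∈T = proj₂ minimal (exchange T b a) (⊂exchange⇒exchange⊂ a≢b a∈S b∈T T⊂)
                                    (IsTDS-exchange Nb⊆Na tdsT)
      ... | no b∉T  = proj₂ minimal T (⊆exchange⇒⊂ a≢b a∈S b∉T (proj₁ T⊂)) tdsT

MinimalTDSSize : ∀ {n} → Graph n → ℕ → Set
MinimalTDSSize H k = ∃ λ S → IsMinimalTDS H S × ∣ S ∣ ≡ k

WellTotallyDominated-transfer : ∀ {n n′} (H : Graph n) (H′ : Graph n′) →
  (∀ {k} → MinimalTDSSize H k → MinimalTDSSize H′ k) →
  WellTotallyDominated H′ → WellTotallyDominated H
WellTotallyDominated-transfer _ _ H→H′ wtd S T minS minT
  with H→H′ (S , minS , refl) | H→H′ (T , minT , refl)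
... | S′ , minS′ , ∣S′∣≡∣S∣ | T′ , minT′ , ∣T′∣≡∣T∣ =
  trans (≡.sym ∣S′∣≡∣S∣) (trans (wtd S′ T′ minS′ minT′) ∣T′∣≡∣T∣)

module Pendant {n m} (G : Graph n) (f : Fin m → Fin n) where

  G′ : Graph (n + m)
  G′ = attachLeaves G m f

  adj-old-old : ∀ x y → adj G′ (x ↑ˡ m) (y ↑ˡ m) ≡ adj G x y
  adj-old-old x y rewrite splitAt-↑ˡ n x m | splitAt-↑ˡ n y m = refl

  adj-new-old : ∀ k y → adj G′ (n ↑ʳ k) (y ↑ˡ m) ≡ ⌊ f k ≟ y ⌋
  adj-new-old k y rewrite splitAt-↑ʳ n m k | splitAt-↑ˡ n y m = refl

  adj-new-new : ∀ k l → adj G′ (n ↑ʳ k) (n ↑ʳ l) ≡ false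
  adj-new-new k l rewrite splitAt-↑ʳ n m k | splitAt-↑ʳ n m l = refl

  Adj′⇒Adj : ∀ {x y} → Adj G′ (x ↑ˡ m) (y ↑ˡ m) → Adj G x y
  Adj′⇒Adj {x} {y} = trans (≡.sym (adj-old-old x y))

  Adj⇒Adj′ : ∀ {x y} → Adj G x y → Adj G′ (x ↑ˡ m) (y ↑ˡ m)
  Adj⇒Adj′ {x} {y} = trans (adj-old-old x y)

  Adj′-new-old⇒ : ∀ {k y} → Adj G′ (n ↑ʳ k) (y ↑ˡ m) → f k ≡ y
  Adj′-new-old⇒ {k} {y} k~y =
    toWitness (Equivalence.from T-≡ (trans (≡.sym (adj-new-old k y)) k~y))

  Adj′-new-support : ∀ k → Adj G′ (n ↑ʳ k) (f k ↑ˡ m)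
  Adj′-new-support k = trans (adj-new-old k (f k)) (Equivalence.to T-≡ (fromWitness refl))

  new-neighbour : ∀ {k i} → Adj G′ (n ↑ʳ k) i → i ≡ f k ↑ˡ m
  new-neighbour {k} {i} k~i with splitAt-view n i
  ... | left y  = cong (_↑ˡ m) (≡.sym (Adj′-new-old⇒ k~i))
  ... | right l = contradiction (trans (≡.sym k~i) (adj-new-new k l)) λ ()

  pendant-support∈TDS : ∀ {S} k → IsTDS G′ S → f k ↑ˡ m ∈ S
  pendant-support∈TDS k = sole-neighbour∈TDS G′ new-neighbour

  module _ {S′ k u} (minimal : IsMinimalTDS G′ S′) (k∈S′ : n ↑ʳ k ∈ S′)
           (fk~u : Adj G (f k) u) where

    N-new⊆N-old : N G′ (n ↑ʳ k) ⊆ N G′ (u ↑ˡ m)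
    N-new⊆N-old v∈ with new-neighbour (∈N⇒Adj G′ v∈)
    ... | refl = Adj⇒∈N G′ (Adj⇒Adj′ (Adj-sym G fk~u))

    old-leaf∉minimalTDS : u ↑ˡ m ∉ S′
    old-leaf∉minimalTDS = N⊆N⇒∉minimalTDS G′ ↑ʳ≢↑ˡ N-new⊆N-old minimal k∈S′

    IsMinimalTDS-exchange-pendant : Leaf G u → IsMinimalTDS G′ (exchange S′ (n ↑ʳ k) (u ↑ˡ m))
    IsMinimalTDS-exchange-pendant leaf =
      IsMinimalTDS-exchange G′ ↑ʳ≢↑ˡ N-new⊆N-old minimal k∈S′ N-old⊆N-new
      where
      u≢fl : ∀ l → u ≢ f l
      u≢fl l refl = old-leaf∉minimalTDS (pendant-support∈TDS l (proj₁ minimal))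
      N-old⊆N-new : N G′ (u ↑ˡ m) ⊆ N G′ (n ↑ʳ k)
      N-old⊆N-new {v} v∈ with splitAt-view n v | ∈N⇒Adj G′ v∈
      ... | left y  | u~y =
        subst (λ z → z ↑ˡ m ∈ N G′ (n ↑ʳ k))
              (leaf-neighbour-unique G leaf (Adj-sym G fk~u) (Adj′⇒Adj u~y))
              (Adj⇒∈N G′ (Adj′-new-support k))
      ... | right l | u~l = contradiction (Adj′-new-old⇒ (Adj-sym G′ u~l)) (u≢fl l ∘ ≡.sym)

  IsTDS-++⊥⁻ : ∀ {S} → IsTDS G′ (S ++ ⊥) → IsTDS G S
  IsTDS-++⊥⁻ {S} tds x with tds (x ↑ˡ m)
  ... | i , i∈ , x~i with splitAt-view n i
  ...   | left y  = y , ∈-++ˡ⁻ S i∈ , Adj′⇒Adj x~i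
  ...   | right k = contradiction (∈-++ʳ⁻ S i∈) ∉⊥

  module _ (supports : ∀ k → Support G (f k)) where

    IsTDS-++⊥ : ∀ {S} → IsTDS G S → IsTDS G′ (S ++ ⊥)
    IsTDS-++⊥ tds i with splitAt-view n i
    ... | right k = f k ↑ˡ m , ∈-++ˡ⁺ (support∈TDS G (supports k) tds) , Adj′-new-support k
    ... | left x with tds x
    ...   | y , y∈S , x~y = y ↑ˡ m , ∈-++ˡ⁺ y∈S , Adj⇒Adj′ x~y

    IsMinimalTDS-++⊥ : ∀ {S} → IsMinimalTDS G S → IsMinimalTDS G′ (S ++ ⊥)
    IsMinimalTDS-++⊥ {S} (tds , no-smaller) = IsTDS-++⊥ tds , no-smaller′
      where
      no-smaller′ : ∀ T′ → T′ ⊂ S ++ ⊥ → ¬ IsTDS G′ T′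
      no-smaller′ T′ T′⊂ tds′ with Vec.splitAt n T′
      ... | T , ys , refl with refl ← ++-⊆-++⊥ {p = T} {p′ = S} {q = ys} (proj₁ T′⊂) =
        no-smaller T (++⊥-⊂⁻ T′⊂) (IsTDS-++⊥⁻ tds′)

    IsMinimalTDS-++⊥⁻ : ∀ {S} → IsMinimalTDS G′ (S ++ ⊥) → IsMinimalTDS G S
    IsMinimalTDS-++⊥⁻ (tds , no-smaller) =
      IsTDS-++⊥⁻ tds , λ T T⊂S tdsT → no-smaller (T ++ ⊥) (++⊥-⊂⁺ T⊂S) (IsTDS-++⊥ tdsT)

    shed-pendants : ∀ xs ys → Acc _<_ ∣ ys ∣ → IsMinimalTDS G′ (xs ++ ys) →
                    MinimalTDSSize G ∣ xs ++ ys ∣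
    shed-pendants xs ys (acc smaller) minimal with nonempty? ys
    ... | no ∄k with refl ← Empty-unique ∄k = xs , IsMinimalTDS-++⊥⁻ minimal , ≡.sym (∣p++⊥∣≡∣p∣ xs)
    ... | yes (k , k∈ys) with supports k
    ...   | u , fk~u , leaf =
      subst (MinimalTDSSize G) ∣exchanged∣
            (shed-pendants (xs [ u ]≔ inside) (ys [ k ]≔ outside) (smaller fewer-pendants) minimal′)
      where
      k∈ : n ↑ʳ k ∈ xs ++ ys
      k∈ = ∈-++ʳ⁺ xs k∈ys
      exchanged : exchange (xs ++ ys) (n ↑ʳ k) (u ↑ˡ m) ≡ (xs [ u ]≔ inside) ++ (ys [ k ]≔ outside)
      exchanged = trans (cong (_[ u ↑ˡ m ]≔ inside) ([]≔-++-↑ʳ xs ys k))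
                        ([]≔-++-↑ˡ xs (ys [ k ]≔ outside) u)
      minimal′ : IsMinimalTDS G′ ((xs [ u ]≔ inside) ++ (ys [ k ]≔ outside))
      minimal′ = subst (IsMinimalTDS G′) exchanged
                       (IsMinimalTDS-exchange-pendant minimal k∈ fk~u leaf)
      ∣exchanged∣ : ∣ (xs [ u ]≔ inside) ++ (ys [ k ]≔ outside) ∣ ≡ ∣ xs ++ ys ∣
      ∣exchanged∣ = trans (cong ∣_∣ (≡.sym exchanged))
                          (∣exchange∣≡∣p∣ k∈ (old-leaf∉minimalTDS minimal k∈ fk~u))
      fewer-pendants : ∣ ys [ k ]≔ outside ∣ < ∣ ys ∣
      fewer-pendants = ≤-reflexive (x∈p⇒1+∣p[x]≔outside∣≡∣p∣ k∈ys)

    MinimalTDSSize-G′⇒G : ∀ {s} → MinimalTDSSize G′ s → MinimalTDSSize G s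
    MinimalTDSSize-G′⇒G (S′ , minimal , refl) with Vec.splitAt n S′
    ... | xs , ys , refl = shed-pendants xs ys (<-wellFounded ∣ ys ∣) minimal

    MinimalTDSSize-G⇒G′ : ∀ {s} → MinimalTDSSize G s → MinimalTDSSize G′ s
    MinimalTDSSize-G⇒G′ (S , minimal , refl) = S ++ ⊥ , IsMinimalTDS-++⊥ minimal , ∣p++⊥∣≡∣p∣ S

lemma2p5 : (n : ℕ) (G : Graph n) → Connected G → HasLeaf G →
           (m : ℕ) (f : Fin m → Fin n) → (∀ k → Support G (f k)) →
           WellTotallyDominated G ⇔ WellTotallyDominated (attachLeaves G m f)
lemma2p5 n G _ _ m f supports = mk⇔
  (WellTotallyDominated-transfer G′ G (MinimalTDSSize-G′⇒G supports))
  (WellTotallyDominated-transfer G G′ (MinimalTDSSize-G⇒G′ supports))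
  where open Pendant G f
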